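{- Let $\mathcal{G}$ be an additive subgroup of $\mathbb{R}$, $n$ a positive integer, and $c,m\in\mathcal{G}$ with $c>0$, $m\geq 0$. For all $g\in S$ and all $j\in\mathbb{Z}$, $C^j(g)$ belongs to $\mathrm{AV}_n$.
   Context: An area vector is $g=(g_0,\ldots,g_{n-1})\in\mathcal{G}^n$ with $g_{i+1}\leq g_i+m$ for $0\leq i<n-1$; $\mathrm{AV}_n$ is the set of area vectors. The cycling operator $C:\mathcal{G}^n\to\mathcal{G}^n$ is $C(g_0,g_1,\ldots,g_{n-1})=(g_1,\ldots,g_{n-1},g_0-c)$; it is a bijection and $C^j$ denotes its $j$-th power for $j\in\mathbb{Z}$. $S=\{g\in\mathrm{AV}_n: g_0\leq c,\ g_{n-1}>0\}$. -}

module Defs where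

open import Level using (Level) renaming (suc to lsuc)
open import Data.Nat using (ℕ; zero; suc)
open import Data.Integer using (ℤ; +_; -[1+_])
open import Data.Fin using (Fin; inject₁; fromℕ) renaming (zero to fzero; suc to fsuc)
open import Data.Vec using (Vec; _∷_; []; _∷ʳ_; lookup; init; last)
open import Data.Product using (_×_; Σ)
open import Data.Sum using (_⊎_)
open import Relation.Nullary using (¬_)
open import Relation.Binary.PropositionalEquality using (_≡_)

times : ∀ {a} {A : Set a} → (A → A → A) → A → ℕ → A → A
times _⊕_ e zero    x = e
times _⊕_ e (suc k) x = x ⊕ times _⊕_ e k x

-- An Archimedean totally ordered abelian group (equality is ≡).
-- By Hölder's theorem these are exactly (up to order-isomorphism) the
-- additive subgroups of ℝ, with the order induced from ℝ.
record ArchOrderedGroup (a : Level) : Set (lsuc a) where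
  infixl 6 _+_ _-_
  infix 4 _≤_ _<_
  field
    Carrier : Set a
    _+_ : Carrier → Carrier → Carrier
    0# : Carrier
    -_ : Carrier → Carrier
    _≤_ : Carrier → Carrier → Set a
    +-assoc : ∀ x y z → (x + y) + z ≡ x + (y + z)
    +-comm : ∀ x y → x + y ≡ y + x
    +-identityˡ : ∀ x → 0# + x ≡ x
    -‿inverseˡ : ∀ x → (- x) + x ≡ 0#
    ≤-refl : ∀ x → x ≤ x
    ≤-trans : ∀ {x y z} → x ≤ y → y ≤ z → x ≤ z
    ≤-antisym : ∀ {x y} → x ≤ y → y ≤ x → x ≡ y
    ≤-total : ∀ x y → (x ≤ y) ⊎ (y ≤ x)
    +-monoˡ-≤ : ∀ {x y} z → x ≤ y → x + z ≤ y + z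
    archimedean : ∀ x y → 0# ≤ x → ¬ (x ≡ 0#) →
                  Σ ℕ (λ k → y ≤ times _+_ 0# k x)
  _-_ : Carrier → Carrier → Carrier
  x - y = x + (- y)
  _<_ : Carrier → Carrier → Set a
  x < y = (x ≤ y) × ¬ (x ≡ y)

module AreaVectors {a : Level} (𝒢 : ArchOrderedGroup a) (c m : ArchOrderedGroup.Carrier 𝒢) where
  open ArchOrderedGroup 𝒢

  -- vectors in 𝒢^n with n = suc k (n positive); g_i = lookup g i
  -- area vector: g_{i+1} ≤ g_i + m for 0 ≤ i < n-1
  IsAV : ∀ {k} → Vec Carrier (suc k) → Set a
  IsAV {k} g = (i : Fin k) → lookup g (fsuc i) ≤ lookup g (inject₁ i) + m

  InS : ∀ {k} → Vec Carrier (suc k) → Set a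
  InS {k} g = IsAV g × (lookup g fzero ≤ c) × (0# < lookup g (fromℕ k))

  C : ∀ {k} → Vec Carrier (suc k) → Vec Carrier (suc k)
  C (x ∷ xs) = xs ∷ʳ (x - c)

  C⁻¹ : ∀ {k} → Vec Carrier (suc k) → Vec Carrier (suc k)
  C⁻¹ g = (last g + c) ∷ init g

  Cpow : ∀ {k} → ℤ → Vec Carrier (suc k) → Vec Carrier (suc k)
  Cpow (+ zero)    g = g
  Cpow (+ suc j)   g = C (Cpow (+ j) g)
  Cpow -[1+ zero ] g = C⁻¹ g
  Cpow -[1+ suc j ] g = C⁻¹ (Cpow -[1+ j ] g)

-- Call g a cyclic area vector if the closed sequence g_0, …, g_{n-1}, g_0 - c is still an area vector.
-- The condition y ≤ x + m is invariant under shifting x and y by the same amount, and C only rotates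
-- the closed sequence by one step (the new closing pair is the old first pair shifted by -c), so C
-- both preserves and reflects cyclicity, hence so does every power C^j.  Every g ∈ S is cyclic,
-- since g_0 - c ≤ 0 < g_{n-1} ≤ g_{n-1} + m.
module Submission where

open import Defs
open import Level using (Level)
open import Data.Nat using (ℕ; suc; zero)
open import Data.Integer using (ℤ; -[1+_]) renaming (+_ to pos)
open import Data.Fin using (Fin; inject₁; fromℕ) renaming (zero to fzero; suc to fsuc)
open import Data.Vec using (Vec; _∷_; []; _∷ʳ_; lookup; head; init; last; initLast)
open import Data.Vec.Properties using (last-∷ʳ)
open import Data.Vec.Relation.Unary.Linked using (Linked; [-]; _∷_)
open import Data.Product using (_×_; _,_; proj₂)
open import Relation.Binary.Core using (Rel)
open import Relation.Binary.PropositionalEquality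
  using (_≡_; refl; sym; trans; cong; subst; subst₂; module ≡-Reasoning)

module OrderedGroupProperties {a : Level} (𝒢 : ArchOrderedGroup a) where
  open ArchOrderedGroup 𝒢
  open ≡-Reasoning

  +-identityʳ : ∀ x → x + 0# ≡ x
  +-identityʳ x = trans (+-comm x 0#) (+-identityˡ x)

  -‿inverseʳ : ∀ x → x - x ≡ 0#
  -‿inverseʳ x = trans (+-comm x (- x)) (-‿inverseˡ x)

  +-cancelʳ : ∀ x t → (x + t) - t ≡ x
  +-cancelʳ x t = begin
    (x + t) - t   ≡⟨ +-assoc x t (- t) ⟩
    x + (t - t)   ≡⟨ cong (x +_) (-‿inverseʳ t) ⟩
    x + 0#        ≡⟨ +-identityʳ x ⟩
    x             ∎

  +-right-comm : ∀ x y z → (x + y) + z ≡ (x + z) + y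
  +-right-comm x y z = begin
    (x + y) + z   ≡⟨ +-assoc x y z ⟩
    x + (y + z)   ≡⟨ cong (x +_) (+-comm y z) ⟩
    x + (z + y)   ≡⟨ +-assoc x z y ⟨
    (x + z) + y   ∎

  x≤y⇒x-y≤0 : ∀ {x y} → x ≤ y → x - y ≤ 0#
  x≤y⇒x-y≤0 {y = y} x≤y = subst (_ ≤_) (-‿inverseʳ y) (+-monoˡ-≤ (- y) x≤y)

  x≤x+y : ∀ x {y} → 0# ≤ y → x ≤ x + y
  x≤x+y x {y} 0≤y = subst₂ _≤_ (+-identityˡ x) (+-comm y x) (+-monoˡ-≤ x 0≤y)

module LinkedProperties {a ℓ : Level} {A : Set a} {R : Rel A ℓ} where

  ∷ʳ⁺ : ∀ {n} {xs : Vec A (suc n)} {z : A} → Linked R xs → R (last xs) z → Linked R (xs ∷ʳ z)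
  ∷ʳ⁺ {xs = _ ∷ []}    [-]        Rxz = Rxz ∷ [-]
  ∷ʳ⁺ {xs = _ ∷ _ ∷ _} (Rxy ∷ Rys) Rxz = Rxy ∷ ∷ʳ⁺ Rys Rxz

  ∷ʳ⁻ : ∀ {n} (xs : Vec A (suc n)) {z : A} → Linked R (xs ∷ʳ z) → Linked R xs × R (last xs) z
  ∷ʳ⁻ (_ ∷ [])     (Rxz ∷ _)   = [-] , Rxz
  ∷ʳ⁻ (_ ∷ y ∷ ys) (Rxy ∷ Rys) = let Ryys , Rlz = ∷ʳ⁻ (y ∷ ys) Rys in Rxy ∷ Ryys , Rlz

  Linked⇒lookup : ∀ {k} {v : Vec A (suc k)} → Linked R v →
                  (i : Fin k) → R (lookup v (inject₁ i)) (lookup v (fsuc i))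
  Linked⇒lookup {v = _ ∷ _ ∷ _} (Rxy ∷ _)   fzero    = Rxy
  Linked⇒lookup {v = _ ∷ _ ∷ _} (_ ∷ Rys)   (fsuc i) = Linked⇒lookup Rys i

  lookup⇒Linked : ∀ {k} (v : Vec A (suc k)) →
                  ((i : Fin k) → R (lookup v (inject₁ i)) (lookup v (fsuc i))) → Linked R v
  lookup⇒Linked (_ ∷ [])     _  = [-]
  lookup⇒Linked (_ ∷ y ∷ ys) Rᵢ = Rᵢ fzero ∷ lookup⇒Linked (y ∷ ys) (λ i → Rᵢ (fsuc i))

lookup-fromℕ : ∀ {a} {A : Set a} {k} (v : Vec A (suc k)) → lookup v (fromℕ k) ≡ last v
lookup-fromℕ (_ ∷ [])     = refl
lookup-fromℕ (_ ∷ y ∷ ys) = lookup-fromℕ (y ∷ ys)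

module CyclicAreaVectors {a : Level} (𝒢 : ArchOrderedGroup a) (c m : ArchOrderedGroup.Carrier 𝒢) where
  open ArchOrderedGroup 𝒢
  open OrderedGroupProperties 𝒢
  open AreaVectors 𝒢 c m
  open LinkedProperties

  infix 4 _↝_
  _↝_ : Rel Carrier a
  x ↝ y = y ≤ x + m

  IsCyclicAV : ∀ {k} → Vec Carrier (suc k) → Set a
  IsCyclicAV g = Linked _↝_ g × (last g ↝ head g - c)

  ↝-shift : ∀ {x y} t → x ↝ y → x + t ↝ y + t
  ↝-shift {x} {y} t x↝y = subst (y + t ≤_) (+-right-comm x m t) (+-monoˡ-≤ t x↝y)

  ↝-unshift : ∀ {x y} t → x + t ↝ y + t → x ↝ y
  ↝-unshift {x} {y} t x+t↝y+t = subst₂ _↝_ (+-cancelʳ x t) (+-cancelʳ y t) (↝-shift (- t) x+t↝y+t)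

  C-preserves-IsCyclicAV : ∀ {k} (g : Vec Carrier (suc k)) → IsCyclicAV g → IsCyclicAV (C g)
  C-preserves-IsCyclicAV (x ∷ [])     ([-] , x↝x-c) = [-] , ↝-shift (- c) x↝x-c
  C-preserves-IsCyclicAV (x ∷ y ∷ ys) (x↝y ∷ y∷ys-linked , last↝x-c) =
    ∷ʳ⁺ y∷ys-linked last↝x-c ,
    subst (_↝ y - c) (sym (last-∷ʳ (x - c) (y ∷ ys))) (↝-shift (- c) x↝y)

  C-reflects-IsCyclicAV : ∀ {k} (g : Vec Carrier (suc k)) → IsCyclicAV (C g) → IsCyclicAV g
  C-reflects-IsCyclicAV (x ∷ [])     ([-] , x-c↝x-c-c) = [-] , ↝-unshift (- c) x-c↝x-c-c
  C-reflects-IsCyclicAV (x ∷ y ∷ ys) (linked , last↝y-c) =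
    let y∷ys-linked , last↝x-c = ∷ʳ⁻ (y ∷ ys) linked
    in  ↝-unshift (- c) (subst (_↝ y - c) (last-∷ʳ (x - c) (y ∷ ys)) last↝y-c) ∷ y∷ys-linked ,
        last↝x-c

  C∘C⁻¹ : ∀ {k} (g : Vec Carrier (suc k)) → C (C⁻¹ g) ≡ g
  C∘C⁻¹ g = trans (cong (init g ∷ʳ_) (+-cancelʳ (last g) c)) (sym (proj₂ (proj₂ (initLast g))))

  C⁻¹-preserves-IsCyclicAV : ∀ {k} (g : Vec Carrier (suc k)) → IsCyclicAV g → IsCyclicAV (C⁻¹ g)
  C⁻¹-preserves-IsCyclicAV g cyclic =
    C-reflects-IsCyclicAV (C⁻¹ g) (subst IsCyclicAV (sym (C∘C⁻¹ g)) cyclic)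

  Cpow-preserves-IsCyclicAV : ∀ {k} (j : ℤ) (g : Vec Carrier (suc k)) →
                              IsCyclicAV g → IsCyclicAV (Cpow j g)
  Cpow-preserves-IsCyclicAV (pos zero)      g cyclic = cyclic
  Cpow-preserves-IsCyclicAV (pos (suc j))   g cyclic =
    C-preserves-IsCyclicAV _ (Cpow-preserves-IsCyclicAV (pos j) g cyclic)
  Cpow-preserves-IsCyclicAV -[1+ zero ]     g cyclic = C⁻¹-preserves-IsCyclicAV g cyclic
  Cpow-preserves-IsCyclicAV -[1+ suc j ]    g cyclic =
    C⁻¹-preserves-IsCyclicAV _ (Cpow-preserves-IsCyclicAV -[1+ j ] g cyclic)

  InS⇒IsCyclicAV : 0# ≤ m → ∀ {k} (g : Vec Carrier (suc k)) → InS g → IsCyclicAV g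
  InS⇒IsCyclicAV 0≤m g@(x ∷ _) (isAV , x≤c , (0≤last , _)) =
    lookup⇒Linked g isAV ,
    ≤-trans (x≤y⇒x-y≤0 x≤c)
            (≤-trans (subst (0# ≤_) (lookup-fromℕ g) 0≤last) (x≤x+y (last g) 0≤m))

  IsCyclicAV⇒IsAV : ∀ {k} {g : Vec Carrier (suc k)} → IsCyclicAV g → IsAV g
  IsCyclicAV⇒IsAV (linked , _) = Linked⇒lookup linked

lemma2p11 : {a : Level} (𝒢 : ArchOrderedGroup a) (c m : ArchOrderedGroup.Carrier 𝒢) →
    ArchOrderedGroup._<_ 𝒢 (ArchOrderedGroup.0# 𝒢) c →
    ArchOrderedGroup._≤_ 𝒢 (ArchOrderedGroup.0# 𝒢) m →
    (k : ℕ) (g : Vec (ArchOrderedGroup.Carrier 𝒢) (suc k)) →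
    AreaVectors.InS 𝒢 c m g →
    (j : ℤ) → AreaVectors.IsAV 𝒢 c m (AreaVectors.Cpow 𝒢 c m j g)
lemma2p11 𝒢 c m _ 0≤m k g g∈S j =
  IsCyclicAV⇒IsAV (Cpow-preserves-IsCyclicAV j g (InS⇒IsCyclicAV 0≤m g g∈S))
  where open CyclicAreaVectors 𝒢 c m
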